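{- Let $q=p^t$ with $p$ prime, $n\ge 2$, and let $\mathcal{D}$ be an affine resolvable $2$-$(q^n,q^{n-1},(q^{n-1}-1)/(q-1))$ design with point-by-block incidence matrix $A$ (with $b$ columns). Let $\mathcal{D}_1$ be a symmetric $2$-$((q^{n+1}-1)/(q-1),(q^n-1)/(q-1),(q^{n-1}-1)/(q-1))$ design having a block $B$ such that the residual design $(\mathcal{D}_1)_B$ is $\mathcal{D}$, and let $A_1$ be a point-by-block incidence matrix of $\mathcal{D}_1$ whose columns are ordered so that the $j$-th column ($1\le j\le b$) corresponds to the block of $\mathcal{D}_1$ whose residual is the $j$-th block of $\mathcal{D}$, and the last column corresponds to $B$. Then $\mathcal{D}$ is linearly embeddable over $GF(p)$ as the residual design $(\mathcal{D}_1)_B$ if and only if every row of $A_1$ lies in the row space over $GF(p)$ of the $(q^n+1)\times(b+1)$ matrix obtained from $A$ by appending an all-zero last column and then appending an all-one row $(1,1,\dots,1)$.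
   Context: A $2$-$(v,k,\lambda)$ design has $v$ points, blocks of size $k$, each pair of points in $\lambda$ blocks; it is symmetric if it has $v$ blocks; affine resolvable means its blocks partition into parallel classes (pairwise disjoint blocks covering all points) and any two non-parallel blocks meet in a constant number of points. For a block $B$ of $\mathcal{D}_1=(X,\mathcal{B})$, the residual design $(\mathcal{D}_1)_B$ has point set $X\setminus B$ and blocks $B_j\setminus B$, $B_j\ne B$. It is linearly embeddable over $GF(p)$ if $\mathrm{rank}_p A_1=\mathrm{rank}_p A+1$, $\mathrm{rank}_p$ denoting rank over $GF(p)$. -}

module Defs where

open import Data.Nat using (ℕ; zero; suc; _+_; _*_; _∸_; _^_; _≤_)
open import Data.Nat.DivMod using (_/_; _%_)
open import Data.Bool using (Bool; true; false; _∧_)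
open import Data.Fin using (Fin; zero; suc; fromℕ; inject₁)
open import Data.Product using (Σ; ∃; _×_; _,_)
open import Relation.Binary.PropositionalEquality using (_≡_; _≢_)
open import Relation.Nullary using (¬_)

_÷_ : ℕ → ℕ → ℕ
m ÷ zero  = 0
m ÷ suc d = m / suc d

-- Congruence modulo p (equality in GF(p) = ℤ/pℤ for p prime).
ModEq : ℕ → ℕ → ℕ → Set
ModEq zero    x y = x ≡ y
ModEq (suc p) x y = x % suc p ≡ y % suc p

∑ : ∀ {n} → (Fin n → ℕ) → ℕ
∑ {zero}  f = 0
∑ {suc n} f = f zero + ∑ (λ i → f (suc i))

bitℕ : Bool → ℕ
bitℕ true  = 1
bitℕ false = 0

count : ∀ {n} → (Fin n → Bool) → ℕ
count f = ∑ (λ i → bitℕ (f i))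

snoc : ∀ {n} {A : Set} → (Fin n → A) → A → Fin (suc n) → A
snoc {zero}  f a zero    = a
snoc {suc n} f a zero    = f zero
snoc {suc n} f a (suc i) = snoc (λ j → f (suc j)) a i

-- Incidence structures: a point-by-block incidence matrix with
-- v points and b blocks (entry true iff the point lies on the block).

Incidence : ℕ → ℕ → Set
Incidence v b = Fin v → Fin b → Bool

Is2Design : ∀ {v b} → Incidence v b → ℕ → ℕ → Set
Is2Design {v} {b} A k lam =
  (∀ (j : Fin b) → count (λ x → A x j) ≡ k) ×
  (∀ (x y : Fin v) → x ≢ y → count (λ j → A x j ∧ A y j) ≡ lam)

IsSymmetric2Design : ∀ {v b} → Incidence v b → ℕ → ℕ → Set
IsSymmetric2Design {v} {b} A k lam = (b ≡ v) × Is2Design A k lam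

IsAffineResolvable : ∀ {v b} → Incidence v b → Set
IsAffineResolvable {v} {b} A =
  Σ ℕ λ r → Σ (Fin b → Fin r) λ cls →
    (∀ (c : Fin r) (x : Fin v) → Σ (Fin b) λ j → (cls j ≡ c) × (A x j ≡ true)) ×
    (∀ (j j' : Fin b) → j ≢ j' → cls j ≡ cls j' →
       ∀ (x : Fin v) → ¬ ((A x j ≡ true) × (A x j' ≡ true))) ×
    (Σ ℕ λ μ → ∀ (j j' : Fin b) → cls j ≢ cls j' →
       count (λ x → A x j ∧ A x j') ≡ μ)

-- A1 (points of D1, blocks of D1 with the last column being the block B)
-- has residual design with respect to its last block equal to A, with the
-- j-th block of A being the residual of the j-th block of A1:
-- φ is a bijection from the points of A onto the points of D1 not on B.
ResidualIs : ∀ {v v₁ b} → Incidence v₁ (suc b) → Incidence v b → Set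
ResidualIs {v} {v₁} {b} A₁ A =
  Σ (Fin v → Fin v₁) λ φ →
    (∀ i i' → φ i ≡ φ i' → i ≡ i') ×
    (∀ i → A₁ (φ i) (fromℕ b) ≡ false) ×
    (∀ x → A₁ x (fromℕ b) ≡ false → Σ (Fin v) λ i → φ i ≡ x) ×
    (∀ i (j : Fin b) → A₁ (φ i) (inject₁ j) ≡ A i j)

-- Linear algebra over GF(p), matrices with natural-number entries read mod p

Mat : ℕ → ℕ → Set
Mat m c = Fin m → Fin c → ℕ

toMat : ∀ {m c} → Incidence m c → Mat m c
toMat A i j = bitℕ (A i j)

LinIndepRows : ∀ {m c r} → ℕ → Mat m c → (Fin r → Fin m) → Set
LinIndepRows {m} {c} {r} p M s =
  (coef : Fin r → ℕ) →
  (∀ (col : Fin c) → ModEq p (∑ (λ k → coef k * M (s k) col)) 0) →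
  ∀ (k : Fin r) → ModEq p (coef k) 0

RankOver : ∀ {m c} → ℕ → Mat m c → ℕ → Set
RankOver {m} {c} p M r =
  (Σ (Fin r → Fin m) λ s → LinIndepRows p M s) ×
  (∀ (s : Fin (suc r) → Fin m) → ¬ LinIndepRows p M s)

InRowSpace : ∀ {m c} → ℕ → Mat m c → (Fin c → ℕ) → Set
InRowSpace {m} {c} p M w =
  Σ (Fin m → ℕ) λ coef →
    ∀ (col : Fin c) → ModEq p (∑ (λ i → coef i * M i col)) (w col)

LinearlyEmbeddable : ∀ {v v₁ b₁ b} → ℕ → Incidence v₁ b₁ → Incidence v b → Set
LinearlyEmbeddable p A₁ A =
  Σ ℕ λ r → RankOver p (toMat A) r × RankOver p (toMat A₁) (suc r)

extendMat : ∀ {v b} → Incidence v b → Mat (suc v) (suc b)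
extendMat A = snoc (λ i → snoc (λ j → bitℕ (A i j)) 0) (λ _ → 1)

-- Each block of D₁ has (qⁿ - 1)/(q - 1) = 1 + q + ⋯ + qⁿ⁻¹ ≡ 1 (mod p) points, so over GF(p)
-- the rows of A₁ sum to the all-one vector 𝟙; and the rows of A₁ of the points off B are the
-- rows of A padded by a 0 entry for B. Hence the row space of A₁ always contains the row space
-- of the extended matrix, which is spanned by 𝟙 together with a basis of the row space of A padded
-- by 0, and so has dimension rank A + 1 (the padded rows vanish in the last column, 𝟙 does not).
-- By Steinitz exchange the two row spaces coincide iff rank A₁ = rank A + 1.

module Submission where

open import Algebra.Bundles using (CommutativeSemiring)
open import Data.Bool using (false)
open import Data.Fin using (Fin; zero; suc; toℕ; fromℕ; fromℕ<; inject₁; punchIn)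
open import Data.Fin.Induction using (>-weakInduction)
open import Data.Fin.Properties using (all?; any?; ¬∀⟶∃¬; toℕ-fromℕ<)
open import Data.Nat using (ℕ; zero; suc; _+_; _*_; _∸_; _^_; _<_; _≤_; z≤n; s≤s)
open import Data.Nat.Base using (nonTrivial⇒n>1; ≢-nonZero)
open import Data.Nat.Coprimality using (coprime-Bézout; prime⇒coprime)
open import Data.Nat.Divisibility using (_∣_; divides; m∣m*n)
open import Data.Nat.DivMod
  using (_%_; _/_; m*n/n≡m; %-distribˡ-+; %-distribˡ-*; m%n%n≡m%n; m%n<n; m<n⇒m%n≡m; m*n%n≡0)
open import Data.Nat.GCD using (module Bézout)
open import Data.Nat.Primality using (Prime; prime⇒nonTrivial; ¬prime[0])
import Data.Nat.Properties as ℕ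
open import Data.Nat.Tactic.RingSolver using (solve-∀)
open import Data.Product using (∃; _×_; _,_; proj₁; proj₂)
open import Data.Vec.Functional using (_∷_; head; tail; insertAt)
open import Data.Vec.Functional.Properties using (insertAt-lookup; insertAt-punchIn)
open import Function using (_∘_)
open import Function.Bundles using (_⇔_; mk⇔)
open import Level using (0ℓ)
open import Relation.Binary.Definitions using (Decidable)
open import Relation.Binary.PropositionalEquality
  using (_≡_; _≗_; refl; sym; trans; cong; cong₂; cong-app; subst; module ≡-Reasoning)
import Relation.Binary.Reasoning.Setoid as SetoidReasoning
open import Relation.Binary.Structures using (IsEquivalence)
open import Relation.Nullary using (¬_; Dec; yes; no; map′; contradiction; ¬?; _×-dec_)
open import Relation.Nullary.Decidable using (decidable-stable)

open import Defs

snoc-inject₁ : ∀ {n} {A : Set} (f : Fin n → A) a i → snoc f a (inject₁ i) ≡ f i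
snoc-inject₁ {suc n} f a zero    = refl
snoc-inject₁ {suc n} f a (suc i) = snoc-inject₁ (f ∘ suc) a i

snoc-last : ∀ {n} {A : Set} (f : Fin n → A) a → snoc f a (fromℕ n) ≡ a
snoc-last {zero}  f a = refl
snoc-last {suc n} f a = snoc-last (f ∘ suc) a

inject₁-last-induction : ∀ {n} {P : Fin (suc n) → Set} →
  (∀ i → P (inject₁ i)) → P (fromℕ n) → ∀ i → P i
inject₁-last-induction {P = P} P-inject₁ P-last = >-weakInduction P P-last λ i _ → P-inject₁ i

pad : ∀ {c} → (Fin c → ℕ) → Fin (suc c) → ℕ
pad x = snoc x 0

any-function? : ∀ n {k} {Q : (Fin n → Fin k) → Set} →
  (∀ {f g} → f ≗ g → Q f → Q g) → (∀ f → Dec (Q f)) → Dec (∃ Q)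
any-function? zero {k} resp Q? = map′ (none ,_) (λ (f , q) → resp (λ ()) q) (Q? none)
  where
  none : Fin 0 → Fin k
  none ()
any-function? (suc n) resp Q? =
  map′ (λ (x , f , q) → x ∷ f , q)
       (λ (f , q) → head f , tail f , resp (λ { zero → refl ; (suc i) → refl }) q)
       (any? λ x → any-function? n (λ f≗g → resp λ { zero → refl ; (suc i) → f≗g i }) (Q? ∘ (x ∷_)))

module Modular (m : ℕ) where

  P : ℕ
  P = suc m

  -- A record rather than the bare equation x % P ≡ y % P, so that x and y can be inferred.
  infix 4 _≈_ _≉_
  record _≈_ (x y : ℕ) : Set where
    constructor mod≡
    field mod-eq : x % P ≡ y % P
  open _≈_ public

  _≉_ : ℕ → ℕ → Set
  x ≉ y = ¬ x ≈ y

  ≡⇒≈ : ∀ {x y} → x ≡ y → x ≈ y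
  ≡⇒≈ x≡y = mod≡ (cong (_% P) x≡y)

  ≈-isEquivalence : IsEquivalence _≈_
  ≈-isEquivalence = record
    { refl  = mod≡ refl
    ; sym   = λ (mod≡ e) → mod≡ (sym e)
    ; trans = λ (mod≡ e) (mod≡ f) → mod≡ (trans e f)
    }

  +-cong : ∀ {x x′ y y′} → x ≈ x′ → y ≈ y′ → x + y ≈ x′ + y′
  +-cong {x} {x′} {y} {y′} (mod≡ e) (mod≡ f) = mod≡ (begin
    (x + y) % P              ≡⟨ %-distribˡ-+ x y P ⟩
    (x % P + y % P) % P      ≡⟨ cong₂ (λ a b → (a + b) % P) e f ⟩
    (x′ % P + y′ % P) % P    ≡⟨ %-distribˡ-+ x′ y′ P ⟨
    (x′ + y′) % P            ∎)
    where open ≡-Reasoning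

  *-cong : ∀ {x x′ y y′} → x ≈ x′ → y ≈ y′ → x * y ≈ x′ * y′
  *-cong {x} {x′} {y} {y′} (mod≡ e) (mod≡ f) = mod≡ (begin
    (x * y) % P              ≡⟨ %-distribˡ-* x y P ⟩
    (x % P * (y % P)) % P    ≡⟨ cong₂ (λ a b → (a * b) % P) e f ⟩
    (x′ % P * (y′ % P)) % P  ≡⟨ %-distribˡ-* x′ y′ P ⟨
    (x′ * y′) % P            ∎)
    where open ≡-Reasoning

  open import Algebra.Structures.Biased _≈_ using (isCommutativeSemiringˡ; isCommutativeMonoidˡ)

  +-*-commutativeSemiring : CommutativeSemiring 0ℓ 0ℓ
  +-*-commutativeSemiring = record
    { Carrier = ℕ ; _≈_ = _≈_ ; _+_ = _+_ ; _*_ = _*_ ; 0# = 0 ; 1# = 1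
    ; isCommutativeSemiring = isCommutativeSemiringˡ record
      { +-isCommutativeMonoid = isCommutativeMonoidˡ record
        { isSemigroup = record
          { isMagma = record { isEquivalence = ≈-isEquivalence ; ∙-cong = +-cong }
          ; assoc   = λ x y z → ≡⇒≈ (ℕ.+-assoc x y z) }
        ; identityˡ = λ x → mod≡ refl
        ; comm      = λ x y → ≡⇒≈ (ℕ.+-comm x y) }
      ; *-isCommutativeMonoid = isCommutativeMonoidˡ record
        { isSemigroup = record
          { isMagma = record { isEquivalence = ≈-isEquivalence ; ∙-cong = *-cong }
          ; assoc   = λ x y z → ≡⇒≈ (ℕ.*-assoc x y z) }
        ; identityˡ = λ x → ≡⇒≈ (ℕ.*-identityˡ x)
        ; comm      = λ x y → ≡⇒≈ (ℕ.*-comm x y) }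
      ; distribʳ = λ x y z → ≡⇒≈ (ℕ.*-distribʳ-+ x y z)
      ; zeroˡ    = λ x → mod≡ refl
      }
    }

  open CommutativeSemiring +-*-commutativeSemiring public
    using ( setoid; semiring; +-assoc; +-comm; +-identityʳ; *-assoc; *-identityˡ; *-identityʳ
          ; zeroˡ; zeroʳ; distribˡ; +-congˡ; +-congʳ; *-congˡ; *-congʳ )
    renaming (refl to ≈-refl; sym to ≈-sym; trans to ≈-trans)

  module ≈-Reasoning = SetoidReasoning setoid

  open import Algebra.Properties.Semiring.Sum semiring public
    using ( sum; sum-cong-≋; sum-cong-≗; sum-remove; sum-replicate-zero
          ; ∑-comm; ∑-distrib-+; *-distribˡ-sum; *-distribʳ-sum )

  _≈?_ : Decidable _≈_
  x ≈? y = map′ mod≡ mod-eq (x % P ℕ.≟ y % P)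

  x%P≈x : ∀ x → x % P ≈ x
  x%P≈x x = mod≡ (m%n%n≡m%n x P)

  reduce : ℕ → Fin P
  reduce x = fromℕ< (m%n<n x P)

  toℕ-reduce : ∀ x → toℕ (reduce x) ≈ x
  toℕ-reduce x = ≈-trans (≡⇒≈ (toℕ-fromℕ< (m%n<n x P))) (x%P≈x x)

  x*P≈0 : ∀ x → x * P ≈ 0
  x*P≈0 x = mod≡ (m*n%n≡0 x P)

  ∣⇒≈0 : ∀ {x} → P ∣ x → x ≈ 0
  ∣⇒≈0 (divides d refl) = x*P≈0 d

  sum≡∑ : ∀ {n} (f : Fin n → ℕ) → sum f ≡ ∑ f
  sum≡∑ {zero}  f = refl
  sum≡∑ {suc n} f = cong (f zero +_) (sum≡∑ (f ∘ suc))

  sum-zero : ∀ {n} {f : Fin n → ℕ} → (∀ k → f k ≈ 0) → sum f ≈ 0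
  sum-zero {n} f≈0 = ≈-trans (sum-cong-≋ f≈0) (sum-replicate-zero n)

  -_ : ℕ → ℕ
  - x = m * x

  +-inverseʳ : ∀ x → x + - x ≈ 0
  +-inverseʳ x = ≈-trans (≡⇒≈ (ℕ.*-comm P x)) (x*P≈0 x)

  +≈0⇒≈- : ∀ {x y} → x + y ≈ 0 → x ≈ - y
  +≈0⇒≈- {x} {y} x+y≈0 = begin
    x               ≈⟨ +-identityʳ x ⟨
    x + 0           ≈⟨ +-congˡ (+-inverseʳ y) ⟨
    x + (y + - y)   ≈⟨ +-assoc x y (- y) ⟨
    x + y + - y     ≈⟨ +-congʳ x+y≈0 ⟩
    - y             ∎
    where open ≈-Reasoning

  x-xβα≈0 : ∀ x {α β} → β * α ≈ 1 → x + - (x * β) * α ≈ 0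
  x-xβα≈0 x {α} {β} βα≈1 = begin
    x + - (x * β) * α   ≡⟨ cong (x +_) (ℕ.*-assoc m (x * β) α) ⟩
    x + - (x * β * α)   ≈⟨ +-congˡ {x} (*-congˡ {m} (*-assoc x β α)) ⟩
    x + - (x * (β * α)) ≈⟨ +-congˡ {x} (*-congˡ {m} (≈-trans (*-congˡ {x} βα≈1) (*-identityʳ x))) ⟩
    x + - x             ≈⟨ +-inverseʳ x ⟩
    0                   ∎
    where open ≈-Reasoning

  module _ (isPrime : Prime P) where

    1≉0 : 1 ≉ 0
    1≉0 (mod≡ 1≡0) = contradiction (trans (sym (m<n⇒m%n≡m 1<P)) 1≡0) λ ()
      where
      1<P : 1 < P
      1<P = nonTrivial⇒n>1 P {{prime⇒nonTrivial isPrime}}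

    inverse : ∀ {x} → x ≉ 0 → ∃ λ y → y * x ≈ 1
    inverse {x} x≉0 with coprime-Bézout (prime⇒coprime isPrime {{≢-nonZero (x≉0 ∘ mod≡)}} (m%n<n x P))
    ... | Bézout.-+ a y eq = y , (begin
      y * x           ≈⟨ *-congˡ {y} (x%P≈x x) ⟨
      y * (x % P)     ≡⟨ eq ⟨
      1 + a * P       ≈⟨ +-congˡ {1} (x*P≈0 a) ⟩
      1               ∎)
      where open ≈-Reasoning
    ... | Bézout.+- a y eq = - y , ≈-sym (begin
      1               ≈⟨ +≈0⇒≈- 1+yx≈0 ⟩
      m * (y * x)     ≡⟨ ℕ.*-assoc m y x ⟨
      - y * x         ∎)
      where
      open ≈-Reasoning
      1+yx≈0 : 1 + y * x ≈ 0
      1+yx≈0 = begin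
        1 + y * x         ≈⟨ +-congˡ {1} (*-congˡ {y} (x%P≈x x)) ⟨
        1 + y * (x % P)   ≡⟨ eq ⟩
        a * P             ≈⟨ x*P≈0 a ⟩
        0                 ∎

module LinearAlgebra (m : ℕ) (isPrime : Prime (suc m)) where

  open Modular m

  private variable
    r s c : ℕ

  lincomb : (Fin r → ℕ) → Mat r c → Fin c → ℕ
  lincomb a w col = sum (λ k → a k * w k col)

  record InSpan (w : Mat r c) (x : Fin c → ℕ) : Set where
    constructor _,_
    field
      coefficients : Fin r → ℕ
      lincomb≈     : ∀ col → lincomb coefficients w col ≈ x col

  Indep : Mat r c → Set
  Indep w = ∀ a → (∀ col → lincomb a w col ≈ 0) → ∀ k → a k ≈ 0

  IsDependency : Mat r c → (Fin r → ℕ) → Set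
  IsDependency w a = (∀ col → lincomb a w col ≈ 0) × ∃ λ k → a k ≉ 0

  Dep : Mat r c → Set
  Dep w = ∃ (IsDependency w)

  Dep⇒¬Indep : {w : Mat r c} → Dep w → ¬ Indep w
  Dep⇒¬Indep (a , a·w≈0 , k , aₖ≉0) indep = aₖ≉0 (indep a a·w≈0 k)

  lincomb-cong : ∀ (a a′ : Fin r → ℕ) (w w′ : Mat r c) col →
    (∀ k → a k ≈ a′ k) → (∀ k → w k col ≈ w′ k col) → lincomb a w col ≈ lincomb a′ w′ col
  lincomb-cong a a′ w w′ col a≈a′ w≈w′ = sum-cong-≋ λ k → *-cong (a≈a′ k) (w≈w′ k)

  lincomb-zero : ∀ {a : Fin r → ℕ} (w : Mat r c) col → (∀ k → a k ≈ 0) → lincomb a w col ≈ 0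
  lincomb-zero w col a≈0 = sum-zero λ k → ≈-trans (*-congʳ (a≈0 k)) (zeroˡ (w k col))

  lincomb-scale : ∀ d (a : Fin r → ℕ) (w : Mat r c) col →
    lincomb (λ k → d * a k) w col ≈ d * lincomb a w col
  lincomb-scale d a w col = begin
    sum (λ k → d * a k * w k col)     ≈⟨ sum-cong-≋ (λ k → *-assoc d (a k) (w k col)) ⟩
    sum (λ k → d * (a k * w k col))   ≈⟨ *-distribˡ-sum d (λ k → a k * w k col) ⟨
    d * lincomb a w col               ∎
    where open ≈-Reasoning

  lincomb-assoc : ∀ (a : Fin r → ℕ) (C : Mat r s) (w : Mat s c) col →
    lincomb a (λ k → lincomb (C k) w) col ≈ lincomb (lincomb a C) w col
  lincomb-assoc a C w col = begin
    sum (λ k → a k * sum (λ i → C k i * w i col))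
      ≈⟨ sum-cong-≋ (λ k → *-distribˡ-sum (a k) (λ i → C k i * w i col)) ⟩
    sum (λ k → sum (λ i → a k * (C k i * w i col)))
      ≈⟨ sum-cong-≋ (λ k → sum-cong-≋ λ i → *-assoc (a k) (C k i) (w i col)) ⟨
    sum (λ k → sum (λ i → a k * C k i * w i col))
      ≈⟨ ∑-comm (λ k i → a k * C k i * w i col) ⟩
    sum (λ i → sum (λ k → a k * C k i * w i col))
      ≈⟨ sum-cong-≋ (λ i → *-distribʳ-sum (w i col) (λ k → a k * C k i)) ⟨
    sum (λ i → lincomb a C i * w i col)
      ∎
    where open ≈-Reasoning

  InSpan-row : ∀ {r c} (w : Mat r c) k → InSpan w (w k)
  InSpan-row {suc r} w k = eₖ , λ col → begin
    lincomb eₖ w col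
      ≈⟨ sum-remove {i = k} (λ i → eₖ i * w i col) ⟩
    eₖ k * w k col + sum (λ j → eₖ (punchIn k j) * w (punchIn k j) col)
      ≡⟨ cong₂ _+_ (cong (_* w k col) (insertAt-lookup _ k 1))
                   (sum-cong-≗ λ j → cong (_* w (punchIn k j) col) (insertAt-punchIn _ k 1 j)) ⟩
    1 * w k col + sum (λ j → 0 * w (punchIn k j) col)
      ≈⟨ +-cong (*-identityˡ (w k col)) (sum-zero λ j → zeroˡ (w (punchIn k j) col)) ⟩
    w k col + 0
      ≈⟨ +-identityʳ (w k col) ⟩
    w k col
      ∎
    where
    open ≈-Reasoning
    eₖ : Fin (suc r) → ℕ
    eₖ = insertAt (λ _ → 0) k 1

  InSpan-resp : ∀ {w : Mat r c} {x y} → (∀ col → x col ≈ y col) → InSpan w x → InSpan w y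
  InSpan-resp x≈y (a , a·w≈x) = a , λ col → ≈-trans (a·w≈x col) (x≈y col)

  InSpan-trans : ∀ {w : Mat s c} {u : Mat r c} {x} → (∀ k → InSpan w (u k)) → InSpan u x → InSpan w x
  InSpan-trans {s} {c} {r} {w} {u} {x} u⊆w (a , a·u≈x) = lincomb a C , λ col → begin
    lincomb (lincomb a C) w col            ≈⟨ lincomb-assoc a C w col ⟨
    lincomb a (λ k → lincomb (C k) w) col  ≈⟨ lincomb-cong a a (λ k → lincomb (C k) w) u col (λ _ → ≈-refl)
                                                (λ k → InSpan.lincomb≈ (u⊆w k) col) ⟩
    lincomb a u col                        ≈⟨ a·u≈x col ⟩
    x col                                  ∎
    where
    open ≈-Reasoning
    C : Mat r s
    C = InSpan.coefficients ∘ u⊆w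

  Dep-zero-column : ∀ {R s} (C : Mat R (suc s)) →
    (∀ k → C k zero ≈ 0) → Dep (λ k i → C k (suc i)) → Dep C
  Dep-zero-column C column₀≈0 (a , a·C≈0 , nonzero) = a , (λ where
      zero    → sum-zero λ k → ≈-trans (*-congˡ {a k} (column₀≈0 k)) (zeroʳ (a k))
      (suc i) → a·C≈0 i)
    , nonzero

  eliminate : ∀ {R c} → Mat (suc R) c → Fin (suc R) → (Fin R → ℕ) → Mat R c
  eliminate C k₀ γ j col = C (punchIn k₀ j) col + γ j * C k₀ col

  lincomb-eliminate : ∀ {R c} (C : Mat (suc R) c) k₀ γ (a : Fin R → ℕ) col →
    lincomb (insertAt a k₀ (sum (λ j → a j * γ j))) C col ≈ lincomb a (eliminate C k₀ γ) col
  lincomb-eliminate {R} C k₀ γ a col = begin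
    lincomb a′ C col
      ≈⟨ sum-remove {i = k₀} (λ k → a′ k * C k col) ⟩
    a′ k₀ * C k₀ col + sum (λ j → a′ (punchIn k₀ j) * Cₚ j)
      ≡⟨ cong₂ _+_ (cong (_* C k₀ col) (insertAt-lookup a k₀ D))
                   (sum-cong-≗ λ j → cong (_* Cₚ j) (insertAt-punchIn a k₀ D j)) ⟩
    D * C k₀ col + sum (λ j → a j * Cₚ j)
      ≈⟨ +-comm (D * C k₀ col) _ ⟩
    sum (λ j → a j * Cₚ j) + D * C k₀ col
      ≈⟨ +-congˡ (*-distribʳ-sum (C k₀ col) (λ j → a j * γ j)) ⟩
    sum (λ j → a j * Cₚ j) + sum (λ j → a j * γ j * C k₀ col)
      ≈⟨ +-congˡ (sum-cong-≋ λ j → *-assoc (a j) (γ j) (C k₀ col)) ⟩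
    sum (λ j → a j * Cₚ j) + sum (λ j → a j * (γ j * C k₀ col))
      ≈⟨ ∑-distrib-+ (λ j → a j * Cₚ j) (λ j → a j * (γ j * C k₀ col)) ⟨
    sum (λ j → a j * Cₚ j + a j * (γ j * C k₀ col))
      ≈⟨ sum-cong-≋ (λ j → distribˡ (a j) (Cₚ j) (γ j * C k₀ col)) ⟨
    lincomb a (eliminate C k₀ γ) col
      ∎
    where
    open ≈-Reasoning
    D : ℕ
    D = sum (λ j → a j * γ j)
    a′ : Fin (suc R) → ℕ
    a′ = insertAt a k₀ D
    Cₚ : Fin R → ℕ
    Cₚ j = C (punchIn k₀ j) col

  Dep-eliminate : ∀ {R c} (C : Mat (suc R) c) k₀ γ → Dep (eliminate C k₀ γ) → Dep C
  Dep-eliminate C k₀ γ (a , a·C′≈0 , j , aⱼ≉0) =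
    insertAt a k₀ (sum (λ j → a j * γ j)) ,
    (λ col → ≈-trans (lincomb-eliminate C k₀ γ a col) (a·C′≈0 col)) ,
    punchIn k₀ j , subst (_≉ 0) (sym (insertAt-punchIn a k₀ _ j)) aⱼ≉0

  -- Gaussian elimination on the first column: it either vanishes and is dropped, or a pivot row
  -- clears it from the other rows; either way one column fewer remains.
  more-rows⇒Dep : ∀ {R} s (C : Mat R s) → s < R → Dep C
  more-rows⇒Dep zero C (s≤s _) = (λ _ → 1) , (λ ()) , zero , 1≉0 isPrime
  more-rows⇒Dep {suc R} (suc s) C (s≤s s<R) with all? (λ k → C k zero ≈? 0)
  ... | yes column₀≈0 =
    Dep-zero-column C column₀≈0 (more-rows⇒Dep s (λ k i → C k (suc i)) (ℕ.m<n⇒m<1+n s<R))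
  ... | no ¬column₀≈0 =
    Dep-eliminate C k₀ γ (Dep-zero-column C′ cleared (more-rows⇒Dep s (λ j i → C′ j (suc i)) s<R))
    where
    pivot : ∃ λ k → C k zero ≉ 0
    pivot = ¬∀⟶∃¬ _ (λ k → C k zero ≈ 0) (λ k → C k zero ≈? 0) ¬column₀≈0
    k₀ : Fin (suc R)
    k₀ = proj₁ pivot
    β⁻¹ : ∃ λ β → β * C k₀ zero ≈ 1
    β⁻¹ = inverse isPrime (proj₂ pivot)
    γ : Fin R → ℕ
    γ j = - (C (punchIn k₀ j) zero * proj₁ β⁻¹)
    C′ : Mat R (suc s)
    C′ = eliminate C k₀ γ
    cleared : ∀ j → C′ j zero ≈ 0
    cleared j = x-xβα≈0 (C (punchIn k₀ j) zero) (proj₂ β⁻¹)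

  Dep-from-coefficients : ∀ {R s c} {w : Mat s c} {u : Mat R c} (C : Mat R s) →
    (∀ k col → lincomb (C k) w col ≈ u k col) → Dep C → Dep u
  Dep-from-coefficients {w = w} {u} C C·w≈u (a , a·C≈0 , nonzero) = a , (λ col → begin
    lincomb a u col                        ≈⟨ lincomb-cong a a u (λ k → lincomb (C k) w) col (λ _ → ≈-refl)
                                                (λ k → ≈-sym (C·w≈u k col)) ⟩
    lincomb a (λ k → lincomb (C k) w) col  ≈⟨ lincomb-assoc a C w col ⟩
    lincomb (lincomb a C) w col            ≈⟨ lincomb-zero w col a·C≈0 ⟩
    0                                      ∎) , nonzero
    where open ≈-Reasoning

  InSpan⇒Dep : ∀ {R s c} {w : Mat s c} {u : Mat R c} → s < R → (∀ k → InSpan w (u k)) → Dep u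
  InSpan⇒Dep {R} {s} s<R u⊆w = Dep-from-coefficients C (InSpan.lincomb≈ ∘ u⊆w) (more-rows⇒Dep s C s<R)
    where
    C : Mat R s
    C = InSpan.coefficients ∘ u⊆w

  Indep⇒≤ : ∀ {R s c} {w : Mat s c} {u : Mat R c} → Indep u → (∀ k → InSpan w (u k)) → R ≤ s
  Indep⇒≤ indep u⊆w = ℕ.≮⇒≥ λ s<R → Dep⇒¬Indep (InSpan⇒Dep s<R u⊆w) indep

  Indep⇒≤cols : ∀ {r c} {w : Mat r c} → Indep w → r ≤ c
  Indep⇒≤cols {c = c} {w} indep = ℕ.≮⇒≥ λ c<r → Dep⇒¬Indep (more-rows⇒Dep c w c<r) indep

  IsDependency? : (w : Mat r c) (a : Fin r → ℕ) → Dec (IsDependency w a)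
  IsDependency? w a = all? (λ col → lincomb a w col ≈? 0) ×-dec any? (λ k → ¬? (a k ≈? 0))

  IsDependency-resp : ∀ (w : Mat r c) {a a′} → (∀ k → a k ≈ a′ k) → IsDependency w a → IsDependency w a′
  IsDependency-resp w {a} {a′} a≈a′ (a·w≈0 , k , aₖ≉0) =
    (λ col → ≈-trans (lincomb-cong a′ a w w col (≈-sym ∘ a≈a′) (λ _ → ≈-refl)) (a·w≈0 col)) ,
    k , λ a′ₖ≈0 → aₖ≉0 (≈-trans (a≈a′ k) a′ₖ≈0)

  -- Coefficients matter only modulo P, so it suffices to search the finitely many Fin P-valued ones.
  Dep? : (w : Mat r c) → Dec (Dep w)
  Dep? {r} w =
    map′ (λ (f , dep) → toℕ ∘ f , dep)
         (λ (a , dep) → reduce ∘ a , IsDependency-resp w (≈-sym ∘ toℕ-reduce ∘ a) dep)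
         (any-function? r (λ f≗g → IsDependency-resp w (≡⇒≈ ∘ cong toℕ ∘ f≗g))
                          (λ f → IsDependency? w (toℕ ∘ f)))

  ¬Dep⇒Indep : {w : Mat r c} → ¬ Dep w → Indep w
  ¬Dep⇒Indep ¬dep a a·w≈0 k = decidable-stable (a k ≈? 0) λ aₖ≉0 → ¬dep (a , a·w≈0 , k , aₖ≉0)

  Indep? : (w : Mat r c) → Dec (Indep w)
  Indep? w = map′ ¬Dep⇒Indep (λ indep dep → Dep⇒¬Indep dep indep) (¬? (Dep? w))

  Indep-resp : ∀ {w w′ : Mat r c} → (∀ k col → w k col ≈ w′ k col) → Indep w → Indep w′
  Indep-resp {w = w} {w′} w≈w′ indep a a·w′≈0 =
    indep a λ col → ≈-trans (lincomb-cong a a w w′ col (λ _ → ≈-refl) (λ k → w≈w′ k col)) (a·w′≈0 col)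

  Dep-∷⇒InSpan : ∀ {w : Mat r c} {x} → Indep w → Dep (x ∷ w) → InSpan w x
  Dep-∷⇒InSpan {c = c} {w} {x} indep (a , a·xw≈0 , k , aₖ≉0) with a zero ≈? 0
  ... | yes a₀≈0 = contradiction (all-zero k) aₖ≉0
    where
    tail≈0 : ∀ col → lincomb (tail a) w col ≈ 0
    tail≈0 col = begin
      lincomb (tail a) w col                   ≈⟨ +-congʳ (≈-trans (*-congʳ a₀≈0) (zeroˡ (x col))) ⟨
      a zero * x col + lincomb (tail a) w col  ≈⟨ a·xw≈0 col ⟩
      0                                        ∎
      where open ≈-Reasoning
    all-zero : ∀ k → a k ≈ 0
    all-zero zero    = a₀≈0
    all-zero (suc k) = indep (tail a) tail≈0 k
  ... | no a₀≉0 = (λ j → - β * a (suc j)) , λ col → ≈-sym (begin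
    x col                                  ≈⟨ +≈0⇒≈- (x+βL≈0 col) ⟩
    m * (β * L col)                        ≡⟨ ℕ.*-assoc m β (L col) ⟨
    - β * L col                            ≈⟨ lincomb-scale (- β) (tail a) w col ⟨
    lincomb (λ j → - β * a (suc j)) w col  ∎)
    where
    open ≈-Reasoning
    β : ℕ
    β = proj₁ (inverse isPrime a₀≉0)
    L : Fin c → ℕ
    L = lincomb (tail a) w
    x+βL≈0 : ∀ col → x col + β * L col ≈ 0
    x+βL≈0 col = begin
      x col + β * L col                ≈⟨ +-congʳ (*-identityˡ (x col)) ⟨
      1 * x col + β * L col            ≈⟨ +-congʳ (*-congʳ (proj₂ (inverse isPrime a₀≉0))) ⟨
      β * a zero * x col + β * L col   ≈⟨ +-congʳ (*-assoc β (a zero) (x col)) ⟩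
      β * (a zero * x col) + β * L col ≈⟨ distribˡ β (a zero * x col) (L col) ⟨
      β * (a zero * x col + L col)     ≈⟨ *-congˡ {β} (a·xw≈0 col) ⟩
      β * 0                            ≈⟨ zeroʳ β ⟩
      0                                ∎

  ¬Indep-∷⇒InSpan : ∀ {w : Mat r c} {x} → Indep w → ¬ Indep (x ∷ w) → InSpan w x
  ¬Indep-∷⇒InSpan {w = w} {x} indep ¬indep =
    Dep-∷⇒InSpan indep (decidable-stable (Dep? (x ∷ w)) (¬indep ∘ ¬Dep⇒Indep {w = x ∷ w}))

  Indep-spans-generators : ∀ {n c} {W u : Mat n c} → Indep W → (∀ k → InSpan u (W k)) →
    ∀ j → InSpan W (u j)
  Indep-spans-generators {W = W} {u} indep W⊆u j = ¬Indep-∷⇒InSpan indep λ indep′ →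
    ℕ.1+n≰n (Indep⇒≤ {u = u j ∷ W} indep′ λ { zero → InSpan-row u j ; (suc k) → W⊆u k })

  lincomb-pad-inject₁ : ∀ (a : Fin r → ℕ) (w : Mat r c) j →
    lincomb a (pad ∘ w) (inject₁ j) ≡ lincomb a w j
  lincomb-pad-inject₁ a w j = sum-cong-≗ λ k → cong (a k *_) (snoc-inject₁ (w k) 0 j)

  lincomb-pad-last : ∀ (a : Fin r → ℕ) (w : Mat r c) → lincomb a (pad ∘ w) (fromℕ c) ≈ 0
  lincomb-pad-last a w = sum-zero λ k → ≈-trans (≡⇒≈ (cong (a k *_) (snoc-last (w k) 0))) (zeroʳ (a k))

  InSpan-pad : ∀ {w : Mat r c} {x} → InSpan w x → InSpan (pad ∘ w) (pad x)
  InSpan-pad {w = w} {x} (a , a·w≈x) = a , inject₁-last-induction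
    (λ j → begin
      lincomb a (pad ∘ w) (inject₁ j)  ≡⟨ lincomb-pad-inject₁ a w j ⟩
      lincomb a w j                    ≈⟨ a·w≈x j ⟩
      x j                              ≡⟨ snoc-inject₁ x 0 j ⟨
      pad x (inject₁ j)                ∎)
    (≈-trans (lincomb-pad-last a w) (≡⇒≈ (sym (snoc-last x 0))))
    where open ≈-Reasoning

  Indep-∷-pad : ∀ {w : Mat r c} y → y (fromℕ c) ≡ 1 → Indep w → Indep (y ∷ pad ∘ w)
  Indep-∷-pad {r} {c} {w} y y-last≡1 indep a a·yw≈0 = λ where
      zero    → a₀≈0
      (suc k) → indep (tail a) tail≈0 k
    where
    open ≈-Reasoning
    a₀≈0 : a zero ≈ 0
    a₀≈0 = begin
      a zero                                   ≈⟨ *-identityʳ (a zero) ⟨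
      a zero * 1                               ≡⟨ cong (a zero *_) y-last≡1 ⟨
      a zero * y (fromℕ c)                     ≈⟨ +-identityʳ _ ⟨
      a zero * y (fromℕ c) + 0                 ≈⟨ +-congˡ {a zero * y (fromℕ c)} (lincomb-pad-last (tail a) w) ⟨
      lincomb a (y ∷ pad ∘ w) (fromℕ c)        ≈⟨ a·yw≈0 (fromℕ c) ⟩
      0                                        ∎
    tail≈0 : ∀ j → lincomb (tail a) w j ≈ 0
    tail≈0 j = begin
      lincomb (tail a) w j                     ≡⟨ lincomb-pad-inject₁ (tail a) w j ⟨
      lincomb (tail a) (pad ∘ w) (inject₁ j)   ≈⟨ +-congʳ (≈-trans (*-congʳ a₀≈0) (zeroˡ (y (inject₁ j)))) ⟨
      lincomb a (y ∷ pad ∘ w) (inject₁ j)      ≈⟨ a·yw≈0 (inject₁ j) ⟩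
      0                                        ∎

  module _ {n c} (M : Mat n c) where

    IndepRows : ℕ → Set
    IndepRows r = ∃ λ (s : Fin r → Fin n) → Indep (M ∘ s)

    IndepRows? : ∀ r → Dec (IndepRows r)
    IndepRows? r = any-function? r (λ s≗s′ → Indep-resp λ k col → ≡⇒≈ (cong (λ i → M i col) (s≗s′ k)))
                                   (Indep? ∘ (M ∘_))

    toIndep : ∀ {r} {s : Fin r → Fin n} → LinIndepRows P M s → Indep (M ∘ s)
    toIndep {s = s} indep a a·M≈0 k = mod≡ (indep a (λ col →
      trans (cong (_% P) (sym (sum≡∑ λ k → a k * M (s k) col))) (mod-eq (a·M≈0 col))) k)

    fromIndep : ∀ {r} {s : Fin r → Fin n} → Indep (M ∘ s) → LinIndepRows P M s
    fromIndep {s = s} indep a a·M≈0 k = mod-eq (indep a (λ col →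
      mod≡ (trans (cong (_% P) (sum≡∑ λ k → a k * M (s k) col)) (a·M≈0 col))) k)

    toInSpan : ∀ {x} → InRowSpace P M x → InSpan M x
    toInSpan (a , a·M≈x) = a , λ col →
      mod≡ (trans (cong (_% P) (sum≡∑ λ i → a i * M i col)) (a·M≈x col))

    fromInSpan : ∀ {x} → InSpan M x → InRowSpace P M x
    fromInSpan (a , a·M≈x) = a , λ col →
      trans (cong (_% P) (sym (sum≡∑ λ i → a i * M i col))) (mod-eq (a·M≈x col))

    rankOver : ∀ {r} → IndepRows r → ¬ IndepRows (suc r) → RankOver P M r
    rankOver (s , indep) ¬rows = (s , fromIndep indep) , λ s′ indep′ → ¬rows (s′ , toIndep {s = s′} indep′)

    -- Independent rows number at most c, so the search for a longer family stops within c steps.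
    rank : ∃ (RankOver P M)
    rank = search c 0 refl ((λ ()) , λ a _ ())
      where
      search : ∀ fuel r → r + fuel ≡ c → IndepRows r → ∃ (RankOver P M)
      search fuel r r+fuel≡c rows with IndepRows? (suc r)
      ... | no ¬rows = r , rankOver rows ¬rows
      search zero r r+0≡c _ | yes (s , indep) =
        contradiction (ℕ.≤-trans (Indep⇒≤cols {w = M ∘ s} indep) (ℕ.≤-reflexive (sym r+0≡c)))
                      (λ 1+r≤r+0 → ℕ.1+n≰n (subst (suc r ≤_) (ℕ.+-identityʳ r) 1+r≤r+0))
      search (suc fuel) r r+1+fuel≡c _ | yes rows′ =
        search fuel (suc r) (trans (sym (ℕ.+-suc r fuel)) r+1+fuel≡c) rows′

    RankOver-basis : ∀ {r} → RankOver P M r →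
      ∃ λ (s : Fin r → Fin n) → Indep (M ∘ s) × ∀ i → InSpan (M ∘ s) (M i)
    RankOver-basis ((s , indep) , maximal) = s , toIndep indep , λ i →
      ¬Indep-∷⇒InSpan (toIndep indep) λ indep′ →
        maximal (i ∷ s) (fromIndep {s = i ∷ s}
          (Indep-resp {w = M i ∷ (M ∘ s)} {M ∘ (i ∷ s)} (λ { zero col → ≈-refl ; (suc k) col → ≈-refl }) indep′))

    RankOver-spanned : ∀ {r} → RankOver P M r → {W : Mat r c} → Indep W → (∀ k → InSpan M (W k)) →
      ∀ i → InSpan W (M i)
    RankOver-spanned rk indep W⊆M i =
      let s , basis , spans = RankOver-basis rk
      in InSpan-trans (Indep-spans-generators indep λ k → InSpan-trans spans (W⊆M k)) (spans i)

    RankOver-intro : ∀ {r} {W : Mat r c} → Indep W → (∀ k → InSpan M (W k)) → (∀ i → InSpan W (M i)) →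
      RankOver P M r
    RankOver-intro indep W⊆M M⊆W =
      let R , rk = rank
          s , basis , spans = RankOver-basis rk
      in subst (RankOver P M) (ℕ.≤-antisym (Indep⇒≤ basis (M⊆W ∘ s))
                                           (Indep⇒≤ indep λ k → InSpan-trans spans (W⊆M k))) rk

module Embedding (m : ℕ) (isPrime : Prime (suc m)) {v v₁ b : ℕ} (A : Mat v b) (A₁ : Mat v₁ (suc b))
  (column-sum≈1 : ∀ j → Modular._≈_ m (Modular.sum m (λ x → A₁ x j)) 1)
  (φ : Fin v → Fin v₁) (A₁∘φ≗pad : ∀ i → A₁ (φ i) ≗ pad (A i)) where

  open Modular m
  open LinearAlgebra m isPrime

  ones : Fin (suc b) → ℕ
  ones _ = 1

  -- Definitionally equal to extendMat when A is an incidence matrix.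
  E : Mat (suc v) (suc b)
  E = snoc (pad ∘ A) ones

  ones∈span-A₁ : InSpan A₁ ones
  ones∈span-A₁ = (λ _ → 1) , λ col → ≈-trans (sum-cong-≋ λ x → *-identityˡ (A₁ x col)) (column-sum≈1 col)

  module _ {r} (s : Fin r → Fin v) where

    W : Mat (suc r) (suc b)
    W = ones ∷ pad ∘ A ∘ s

    W-indep : Indep (A ∘ s) → Indep W
    W-indep = Indep-∷-pad ones refl

    W⊆A₁ : ∀ k → InSpan A₁ (W k)
    W⊆A₁ zero    = ones∈span-A₁
    W⊆A₁ (suc k) = InSpan-resp (≡⇒≈ ∘ A₁∘φ≗pad (s k)) (InSpan-row A₁ (φ (s k)))

    W⊆E : ∀ k → InSpan E (W k)
    W⊆E zero    = InSpan-resp (≡⇒≈ ∘ cong-app (snoc-last (pad ∘ A) ones)) (InSpan-row E (fromℕ v))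
    W⊆E (suc k) = InSpan-resp (≡⇒≈ ∘ cong-app (snoc-inject₁ (pad ∘ A) ones (s k)))
                              (InSpan-row E (inject₁ (s k)))

    E⊆W : (∀ i → InSpan (A ∘ s) (A i)) → ∀ i → InSpan W (E i)
    E⊆W spans = inject₁-last-induction
      (λ i → InSpan-resp (≡⇒≈ ∘ cong-app (sym (snoc-inject₁ (pad ∘ A) ones i)))
               (InSpan-trans (λ k → InSpan-row W (suc k)) (InSpan-pad (spans i))))
      (InSpan-resp (≡⇒≈ ∘ cong-app (sym (snoc-last (pad ∘ A) ones))) (InSpan-row W zero))

  rank-suc⇔rows-in-E : (∃ λ r → RankOver P A r × RankOver P A₁ (suc r)) ⇔ (∀ x → InRowSpace P E (A₁ x))
  rank-suc⇔rows-in-E = mk⇔ to from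
    where
    to : (∃ λ r → RankOver P A r × RankOver P A₁ (suc r)) → ∀ x → InRowSpace P E (A₁ x)
    to (r , rank-A , rank-A₁) x =
      let s , basis , _ = RankOver-basis A rank-A
      in fromInSpan E (InSpan-trans (W⊆E s) (RankOver-spanned A₁ rank-A₁ (W-indep s basis) (W⊆A₁ s) x))

    from : (∀ x → InRowSpace P E (A₁ x)) → ∃ λ r → RankOver P A r × RankOver P A₁ (suc r)
    from A₁⊆E =
      let r , rank-A = rank A
          s , basis , spans = RankOver-basis A rank-A
      in r , rank-A , RankOver-intro A₁ (W-indep s basis) (W⊆A₁ s)
                        (λ x → InSpan-trans (E⊆W s spans) (toInSpan E (A₁⊆E x)))

geometric : ℕ → ℕ → ℕ
geometric q zero    = 0
geometric q (suc n) = 1 + q * geometric q n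

geometric-closed-form : ∀ d n → suc d * geometric (2 + d) n + 1 ≡ (2 + d) ^ n
geometric-closed-form d zero    = cong (_+ 1) (ℕ.*-zeroʳ d)
geometric-closed-form d (suc n) =
  trans (step d (geometric (2 + d) n)) (cong ((2 + d) *_) (geometric-closed-form d n))
  where
  step : ∀ d g → suc d * (1 + (2 + d) * g) + 1 ≡ (2 + d) * (suc d * g + 1)
  step = solve-∀

repunit≡geometric : ∀ q n → 2 ≤ q → (q ^ n ∸ 1) ÷ (q ∸ 1) ≡ geometric q n
repunit≡geometric (suc (suc d)) n (s≤s (s≤s z≤n)) = begin
  ((2 + d) ^ n ∸ 1) / suc d     ≡⟨ cong (λ x → (x ∸ 1) / suc d) (geometric-closed-form d n) ⟨
  (suc d * g + 1 ∸ 1) / suc d   ≡⟨ cong (_/ suc d) (ℕ.m+n∸n≡m (suc d * g) 1) ⟩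
  (suc d * g) / suc d           ≡⟨ cong (_/ suc d) (ℕ.*-comm (suc d) g) ⟩
  (g * suc d) / suc d           ≡⟨ m*n/n≡m g (suc d) ⟩
  g                             ∎
  where
  open ≡-Reasoning
  g : ℕ
  g = geometric (2 + d) n

geometric≈1 : ∀ m {q} n → suc m ∣ q → Modular._≈_ m (geometric q (suc n)) 1
geometric≈1 m {q} n p∣q = +-congˡ {1} (≈-trans (*-congʳ (∣⇒≈0 p∣q)) (zeroˡ (geometric q n)))
  where open Modular m

residual-row : ∀ {v v₁ b} {A : Incidence v b} {A₁ : Incidence v₁ (suc b)} {x i} →
  A₁ x (fromℕ b) ≡ false → (∀ j → A₁ x (inject₁ j) ≡ A i j) → toMat A₁ x ≗ pad (toMat A i)
residual-row {A = A} {i = i} x∉B agrees = inject₁-last-induction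
  (λ j → trans (cong bitℕ (agrees j)) (sym (snoc-inject₁ (toMat A i) 0 j)))
  (trans (cong bitℕ x∉B) (sym (snoc-last (toMat A i) 0)))

lemma5p2 : ∀ (p t n : ℕ) → Prime p → 1 ≤ t → 2 ≤ n →
    let q = p ^ t in
    ∀ {b : ℕ} (A : Incidence (q ^ n) b)
      (A₁ : Incidence ((q ^ (n + 1) ∸ 1) ÷ (q ∸ 1)) (suc b)) →
    Is2Design A (q ^ (n ∸ 1)) ((q ^ (n ∸ 1) ∸ 1) ÷ (q ∸ 1)) →
    IsAffineResolvable A →
    IsSymmetric2Design A₁ ((q ^ n ∸ 1) ÷ (q ∸ 1)) ((q ^ (n ∸ 1) ∸ 1) ÷ (q ∸ 1)) →
    ResidualIs A₁ A →
    (LinearlyEmbeddable p A₁ A ⇔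
      (∀ (x : Fin ((q ^ (n + 1) ∸ 1) ÷ (q ∸ 1))) →
         InRowSpace p (extendMat A) (toMat A₁ x)))
lemma5p2 zero    t       n       p-prime = contradiction p-prime ¬prime[0]
lemma5p2 (suc m) zero    n       p-prime ()
lemma5p2 (suc m) (suc t) zero    p-prime _ ()
lemma5p2 (suc m) (suc t) (suc n) p-prime _ _ A A₁ _ _ (_ , block-size , _) (φ , _ , φ∉B , _ , agrees) =
  Embedding.rank-suc⇔rows-in-E m p-prime (toMat A) (toMat A₁) column-sum≈1 φ
    (λ i → residual-row {A = A} {A₁} (φ∉B i) (agrees i))
  where
  open Modular m
  q : ℕ
  q = P ^ suc t
  2≤q : 2 ≤ q
  2≤q = ℕ.≤-trans (nonTrivial⇒n>1 P {{prime⇒nonTrivial p-prime}}) (ℕ.m≤m*n P (P ^ t) {{ℕ.m^n≢0 P t}})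
  column-sum≈1 : ∀ j → sum (λ x → toMat A₁ x j) ≈ 1
  column-sum≈1 j = begin
    sum (λ x → toMat A₁ x j)    ≡⟨ sum≡∑ (λ x → toMat A₁ x j) ⟩
    count (λ x → A₁ x j)        ≡⟨ block-size j ⟩
    (q ^ suc n ∸ 1) ÷ (q ∸ 1)   ≡⟨ repunit≡geometric q (suc n) 2≤q ⟩
    geometric q (suc n)         ≈⟨ geometric≈1 m n (m∣m*n (P ^ t)) ⟩
    1                           ∎
    where open ≈-Reasoning
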